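{- wBIL is equivalential with equivalence formulas $\Delta(x,y)=\{(\neg{\sim})^n(x\leftrightarrow y)\mid n\in\mathbb{N}\}$; that is: (R) $\vdash_w\Delta(x,x)$; (MP') $x,\Delta(x,y)\vdash_w y$; (Re) for every connective $\lambda\in\{\top,\bot,\wedge,\vee,\to,\prec\}$ of arity $n$: $\Delta(x_1,y_1),\dots,\Delta(x_n,y_n)\vdash_w\Delta(\lambda x_1\dots x_n,\lambda y_1\dots y_n)$.
   Context: Fix a countably infinite set $\mathrm{Prop}$ of propositional variables (here $x,y,x_i,y_i$ denote distinct variables). Bi-intuitionistic formulas are generated by $\phi ::= p \mid \bot \mid \top \mid \phi\wedge\phi \mid \phi\vee\phi \mid \phi\to\phi \mid \phi\prec\phi$ with $p\in\mathrm{Prop}$ ($\prec$ is exclusion). Abbreviations: $\neg\phi := \phi\to\bot$, ${\sim}\phi := \top\prec\phi$, $\phi\leftrightarrow\psi := (\phi\to\psi)\wedge(\psi\to\phi)$, $(\neg{\sim})^0\phi:=\phi$, $(\neg{\sim})^{n+1}\phi:=\neg{\sim}(\neg{\sim})^n\phi$. An axiom is any instance of: (A1) $\phi\to(\psi\to\phi)$; (A2) $(\phi\to(\psi\to\chi))\to((\phi\to\psi)\to(\phi\to\chi))$; (A3) $\phi\to(\phi\vee\psi)$; (A4) $\psi\to(\phi\vee\psi)$; (A5) $(\phi\to\chi)\to((\psi\to\chi)\to((\phi\vee\psi)\to\chi))$; (A6) $(\phi\wedge\psi)\to\phi$; (A7) $(\phi\wedge\psi)\to\psi$; (A8) $(\chi\to\phi)\to((\chi\to\psi)\to(\chi\to(\phi\wedge\psi)))$;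 (A9) $\bot\to\phi$; (A10) $\phi\to\top$; (A11) $\phi\to(\psi\vee(\phi\prec\psi))$; (A12) $(\phi\prec\psi)\to{\sim}(\phi\to\psi)$; (A13) $((\phi\prec\psi)\prec\chi)\to(\phi\prec(\psi\vee\chi))$; (A14) $\neg(\phi\prec\psi)\to(\phi\to\psi)$. wBIL is the relation $\Gamma\vdash_w\phi$ holding iff $\Gamma\vdash\phi$ is derivable with: (Ax) $\Gamma\vdash\phi$ for any axiom $\phi$; (El) $\Gamma\vdash\phi$ if $\phi\in\Gamma$; (MP) from $\Gamma\vdash\phi$ and $\Gamma\vdash\phi\to\psi$ infer $\Gamma\vdash\psi$; (wDN) from $\emptyset\vdash\phi$ infer $\Gamma\vdash\neg{\sim}\phi$. $\Delta(\phi,\psi)$ denotes $\Delta(x,y)$ with $x,y$ replaced by $\phi,\psi$; a set on the right of $\vdash_w$ means each member is derivable; commas on the left denote union. -}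

module Defs where

open import Data.Nat using (ℕ; zero; suc)
open import Data.Product using (∃)
open import Data.Sum using (_⊎_)
open import Relation.Binary.PropositionalEquality using (_≡_)
open import Relation.Nullary using (¬_)

Prop : Set
Prop = ℕ

infixr 6 _∧_
infixr 5 _∨_
infixr 4 _⇒_
infixr 4 _≺_

data Fm : Set where
  var  : Prop → Fm
  ⊥f   : Fm
  ⊤f   : Fm
  _∧_  : Fm → Fm → Fm
  _∨_  : Fm → Fm → Fm
  _⇒_  : Fm → Fm → Fm
  _≺_  : Fm → Fm → Fm

¬f : Fm → Fm
¬f φ = φ ⇒ ⊥f

∼f : Fm → Fm
∼f φ = ⊤f ≺ φ

_⇔_ : Fm → Fm → Fm
φ ⇔ ψ = (φ ⇒ ψ) ∧ (ψ ⇒ φ)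

¬∼^ : ℕ → Fm → Fm
¬∼^ zero φ = φ
¬∼^ (suc n) φ = ¬f (∼f (¬∼^ n φ))

FmSet : Set₁
FmSet = Fm → Set

∅ : FmSet
∅ _ = Data.Empty.⊥
  where import Data.Empty

_∪_ : FmSet → FmSet → FmSet
(Γ ∪ Θ) φ = Γ φ ⊎ Θ φ

⟦_⟧ : Fm → FmSet
⟦ φ ⟧ ψ = ψ ≡ φ

data Axiom : Fm → Set where
  A1  : ∀ φ ψ → Axiom (φ ⇒ (ψ ⇒ φ))
  A2  : ∀ φ ψ χ → Axiom ((φ ⇒ (ψ ⇒ χ)) ⇒ ((φ ⇒ ψ) ⇒ (φ ⇒ χ)))
  A3  : ∀ φ ψ → Axiom (φ ⇒ (φ ∨ ψ))
  A4  : ∀ φ ψ → Axiom (ψ ⇒ (φ ∨ ψ))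
  A5  : ∀ φ ψ χ → Axiom ((φ ⇒ χ) ⇒ ((ψ ⇒ χ) ⇒ ((φ ∨ ψ) ⇒ χ)))
  A6  : ∀ φ ψ → Axiom ((φ ∧ ψ) ⇒ φ)
  A7  : ∀ φ ψ → Axiom ((φ ∧ ψ) ⇒ ψ)
  A8  : ∀ φ ψ χ → Axiom ((χ ⇒ φ) ⇒ ((χ ⇒ ψ) ⇒ (χ ⇒ (φ ∧ ψ))))
  A9  : ∀ φ → Axiom (⊥f ⇒ φ)
  A10 : ∀ φ → Axiom (φ ⇒ ⊤f)
  A11 : ∀ φ ψ → Axiom (φ ⇒ (ψ ∨ (φ ≺ ψ)))
  A12 : ∀ φ ψ → Axiom ((φ ≺ ψ) ⇒ ∼f (φ ⇒ ψ))
  A13 : ∀ φ ψ χ → Axiom (((φ ≺ ψ) ≺ χ) ⇒ (φ ≺ (ψ ∨ χ)))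
  A14 : ∀ φ ψ → Axiom (¬f (φ ≺ ψ) ⇒ (φ ⇒ ψ))

infix 2 _⊢w_
data _⊢w_ (Γ : FmSet) : Fm → Set where
  ax  : ∀ {φ} → Axiom φ → Γ ⊢w φ
  el  : ∀ {φ} → Γ φ → Γ ⊢w φ
  mp  : ∀ {φ ψ} → Γ ⊢w φ → Γ ⊢w (φ ⇒ ψ) → Γ ⊢w ψ
  wdn : ∀ {φ} → ∅ ⊢w φ → Γ ⊢w ¬f (∼f φ)

_⊢wS_ : FmSet → FmSet → Set
Γ ⊢wS Θ = ∀ φ → Θ φ → Γ ⊢w φ

Δ : Fm → Fm → FmSet
Δ φ ψ χ = ∃ λ n → χ ≡ ¬∼^ n (φ ⇔ ψ)

-- Since (wDN) only acts on theorems, wBIL has the deduction theorem, so the intuitionistic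
-- congruences (a ⇔ a') ⇒ (b ⇔ b') ⇒ (a ∘ b ⇔ a' ∘ b') for ∧, ∨, ⇒ are theorems.  The operator
-- ¬∼ is monotone and commutes with binary conjunction of premises, so such a theorem lifts to
-- (¬∼)ⁿ(a ⇔ a') ⇒ (¬∼)ⁿ(b ⇔ b') ⇒ (¬∼)ⁿ(a ∘ b ⇔ a' ∘ b') for every n, which is (Re).
-- Exclusion is only congruent one level down: ¬∼(a ⇔ a') ⇒ ¬∼(b ⇔ b') ⇒ (a ≺ b ⇔ a' ≺ b'),
-- a consequence of dual residuation; the lifted form then uses the members of Δ at depth n + 1.
module Submission where

open import Defs
open import Data.Nat using (ℕ; zero; suc; _+_)
open import Data.Product using (_×_; _,_)
open import Data.Sum using (inj₁; inj₂)
open import Relation.Binary.PropositionalEquality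
  using (_≢_; _≡_; refl; cong)

infixl 5 _,,_
_,,_ : FmSet → Fm → FmSet
Γ ,, φ = Γ ∪ ⟦ φ ⟧

weaken : ∀ {Γ Θ φ} → (∀ ψ → Γ ψ → Θ ψ) → Γ ⊢w φ → Θ ⊢w φ
weaken Γ⊆Θ (ax a)    = ax a
weaken Γ⊆Θ (el φ∈Γ)  = el (Γ⊆Θ _ φ∈Γ)
weaken Γ⊆Θ (mp d e)  = mp (weaken Γ⊆Θ d) (weaken Γ⊆Θ e)
weaken Γ⊆Θ (wdn d)   = wdn d

fromTheorem : ∀ {Γ φ} → ∅ ⊢w φ → Γ ⊢w φ
fromTheorem = weaken (λ _ ())

weaken₁ : ∀ {Γ ψ φ} → Γ ⊢w φ → Γ ,, ψ ⊢w φ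
weaken₁ = weaken (λ _ → inj₁)

#0 : ∀ {Γ φ} → Γ ,, φ ⊢w φ
#0 = el (inj₂ refl)

#1 : ∀ {Γ φ ψ} → Γ ,, φ ,, ψ ⊢w φ
#1 = weaken₁ #0

#2 : ∀ {Γ φ ψ χ} → Γ ,, φ ,, ψ ,, χ ⊢w φ
#2 = weaken₁ #1

#3 : ∀ {Γ φ ψ χ θ} → Γ ,, φ ,, ψ ,, χ ,, θ ⊢w φ
#3 = weaken₁ #2

infixl 9 _·_
_·_ : ∀ {Γ φ ψ} → Γ ⊢w φ ⇒ ψ → Γ ⊢w φ → Γ ⊢w ψ
f · x = mp x f

⇒-refl : ∀ {Γ φ} → Γ ⊢w φ ⇒ φ
⇒-refl {φ = φ} = ax (A2 φ (φ ⇒ φ) φ) · ax (A1 φ (φ ⇒ φ)) · ax (A1 φ φ)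

deduction : ∀ {Γ φ ψ} → Γ ,, φ ⊢w ψ → Γ ⊢w φ ⇒ ψ
deduction (ax a)            = ax (A1 _ _) · ax a
deduction (el (inj₁ ψ∈Γ))   = ax (A1 _ _) · el ψ∈Γ
deduction (el (inj₂ refl))  = ⇒-refl
deduction (mp d e)          = ax (A2 _ _ _) · deduction e · deduction d
deduction (wdn d)           = ax (A1 _ _) · wdn d

∧-intro : ∀ {Γ φ ψ} → Γ ⊢w φ → Γ ⊢w ψ → Γ ⊢w φ ∧ ψ
∧-intro {φ = φ} {ψ} x y = ax (A8 φ ψ φ) · ⇒-refl · (ax (A1 ψ φ) · y) · x

∧-elimˡ : ∀ {Γ φ ψ} → Γ ⊢w φ ∧ ψ → Γ ⊢w φ
∧-elimˡ p = ax (A6 _ _) · p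

∧-elimʳ : ∀ {Γ φ ψ} → Γ ⊢w φ ∧ ψ → Γ ⊢w ψ
∧-elimʳ p = ax (A7 _ _) · p

∨-introˡ : ∀ {Γ φ ψ} → Γ ⊢w φ → Γ ⊢w φ ∨ ψ
∨-introˡ p = ax (A3 _ _) · p

∨-introʳ : ∀ {Γ φ ψ} → Γ ⊢w ψ → Γ ⊢w φ ∨ ψ
∨-introʳ p = ax (A4 _ _) · p

∨-elim : ∀ {Γ φ ψ χ} → Γ ⊢w φ ∨ ψ → Γ ,, φ ⊢w χ → Γ ,, ψ ⊢w χ → Γ ⊢w χ
∨-elim d l r = ax (A5 _ _ _) · deduction l · deduction r · d

⊥f-elim : ∀ {Γ φ} → Γ ⊢w ⊥f → Γ ⊢w φ
⊥f-elim p = ax (A9 _) · p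

⊤f-intro : ∀ {Γ} → Γ ⊢w ⊤f
⊤f-intro = ax (A10 (⊤f ⇒ ⊤f)) · ⇒-refl

∼-excludedMiddle : ∀ {Γ φ} → Γ ⊢w φ ∨ ∼f φ
∼-excludedMiddle {φ = φ} = ax (A11 ⊤f φ) · ⊤f-intro

⇒-to-¬≺ : ∀ {φ ψ} → ∅ ⊢w φ ⇒ ψ → ∅ ⊢w ¬f (φ ≺ ψ)
⇒-to-¬≺ d = deduction (weaken₁ (wdn d) · (ax (A12 _ _) · #0))

≺-residuation : ∀ {φ ψ χ} → ∅ ⊢w φ ⇒ (ψ ∨ χ) → ∅ ⊢w (φ ≺ ψ) ⇒ χ
≺-residuation {φ} {ψ} {χ} d =
  ax (A14 (φ ≺ ψ) χ) · deduction (weaken₁ (⇒-to-¬≺ d) · (ax (A13 φ ψ χ) · #0))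

∼-antimono : ∀ {φ ψ} → ∅ ⊢w φ ⇒ ψ → ∅ ⊢w ∼f ψ ⇒ ∼f φ
∼-antimono d = ≺-residuation (deduction
  (∨-elim ∼-excludedMiddle (∨-introˡ (fromTheorem d · #0)) (∨-introʳ #0)))

¬∼-mono : ∀ {φ ψ} → ∅ ⊢w φ ⇒ ψ → ∅ ⊢w ¬f (∼f φ) ⇒ ¬f (∼f ψ)
¬∼-mono d = deduction (deduction (#1 · (fromTheorem (∼-antimono d) · #0)))

∼-∧-split : ∀ {φ ψ} → ∅ ⊢w ∼f (φ ∧ ψ) ⇒ (∼f φ ∨ ∼f ψ)
∼-∧-split = ≺-residuation (deduction
  (∨-elim ∼-excludedMiddle
    (∨-elim ∼-excludedMiddle (∨-introˡ (∧-intro #1 #0)) (∨-introʳ (∨-introʳ #0)))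
    (∨-introʳ (∨-introˡ #0))))

¬∼-∧ : ∀ {φ ψ} → ∅ ⊢w ¬f (∼f φ) ⇒ (¬f (∼f ψ) ⇒ ¬f (∼f (φ ∧ ψ)))
¬∼-∧ = deduction (deduction (deduction
  (∨-elim (fromTheorem ∼-∧-split · #0) (#3 · #0) (#2 · #0))))

¬∼^-mono₂ : ∀ {φ ψ χ} → ∅ ⊢w φ ⇒ (ψ ⇒ χ) →
            ∀ n → ∅ ⊢w ¬∼^ n φ ⇒ (¬∼^ n ψ ⇒ ¬∼^ n χ)
¬∼^-mono₂ d zero    = d
¬∼^-mono₂ {φ} {ψ} {χ} d (suc n) = deduction (deduction
  (fromTheorem (¬∼-mono uncurried) · (fromTheorem ¬∼-∧ · #1 · #0)))
  where
  uncurried : ∅ ⊢w (¬∼^ n φ ∧ ¬∼^ n ψ) ⇒ ¬∼^ n χ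
  uncurried = deduction (fromTheorem (¬∼^-mono₂ d n) · ∧-elimˡ #0 · ∧-elimʳ #0)

¬∼^-+ : ∀ m n φ → ¬∼^ m (¬∼^ n φ) ≡ ¬∼^ (m + n) φ
¬∼^-+ zero    n φ = refl
¬∼^-+ (suc m) n φ = cong (λ ψ → ¬f (∼f ψ)) (¬∼^-+ m n φ)

Δ-refl : ∀ φ → ∅ ⊢wS Δ φ φ
Δ-refl φ _ (n , refl) = go n
  where
  go : ∀ n → ∅ ⊢w ¬∼^ n (φ ⇔ φ)
  go zero    = ∧-intro ⇒-refl ⇒-refl
  go (suc n) = wdn (go n)

Δ-mp : ∀ φ ψ → ⟦ φ ⟧ ∪ Δ φ ψ ⊢w ψ
Δ-mp φ ψ = ∧-elimˡ (el (inj₂ (0 , refl))) · el (inj₁ refl)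

Δ-cong₂ : (_∘_ : Fm → Fm → Fm) (k : ℕ) →
  (∀ a a' b b' → ∅ ⊢w ¬∼^ k (a ⇔ a') ⇒ (¬∼^ k (b ⇔ b') ⇒ ((a ∘ b) ⇔ (a' ∘ b')))) →
  ∀ a a' b b' → (Δ a a' ∪ Δ b b') ⊢wS Δ (a ∘ b) (a' ∘ b')
Δ-cong₂ _∘_ k cong∘ a a' b b' _ (n , refl) =
  fromTheorem (¬∼^-mono₂ (cong∘ a a' b b') n) · premise inj₁ · premise inj₂
  where
  premise : ∀ {c c'} → (∀ {χ} → Δ c c' χ → (Δ a a' ∪ Δ b b') χ) →
            Δ a a' ∪ Δ b b' ⊢w ¬∼^ n (¬∼^ k (c ⇔ c'))
  premise inΓ = el (inΓ (n + k , ¬∼^-+ n k _))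

∧-cong : ∀ a a' b b' → ∅ ⊢w (a ⇔ a') ⇒ ((b ⇔ b') ⇒ ((a ∧ b) ⇔ (a' ∧ b')))
∧-cong a a' b b' = deduction (deduction (∧-intro
  (deduction (∧-intro (∧-elimˡ #2 · ∧-elimˡ #0) (∧-elimˡ #1 · ∧-elimʳ #0)))
  (deduction (∧-intro (∧-elimʳ #2 · ∧-elimˡ #0) (∧-elimʳ #1 · ∧-elimʳ #0)))))

∨-cong : ∀ a a' b b' → ∅ ⊢w (a ⇔ a') ⇒ ((b ⇔ b') ⇒ ((a ∨ b) ⇔ (a' ∨ b')))
∨-cong a a' b b' = deduction (deduction (∧-intro
  (deduction (∨-elim #0 (∨-introˡ (∧-elimˡ #3 · #0)) (∨-introʳ (∧-elimˡ #2 · #0))))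
  (deduction (∨-elim #0 (∨-introˡ (∧-elimʳ #3 · #0)) (∨-introʳ (∧-elimʳ #2 · #0))))))

⇒-cong : ∀ a a' b b' → ∅ ⊢w (a ⇔ a') ⇒ ((b ⇔ b') ⇒ ((a ⇒ b) ⇔ (a' ⇒ b')))
⇒-cong a a' b b' = deduction (deduction (∧-intro
  (deduction (deduction (∧-elimˡ #2 · (#1 · (∧-elimʳ #3 · #0)))))
  (deduction (deduction (∧-elimʳ #2 · (#1 · (∧-elimˡ #3 · #0)))))))

-- In both lemmas the case ∼(premise) of excluded middle is refuted by the ¬∼ hypothesis.
≺-monoˡ : ∀ a a' b → ∅ ⊢w ¬f (∼f (a ⇒ a')) ⇒ ((a ≺ b) ⇒ (a' ≺ b))
≺-monoˡ a a' b = deduction (deduction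
  (∨-elim (fromTheorem (≺-residuation split) · #0) #0 (⊥f-elim (#2 · #0))))
  where
  split : ∅ ⊢w a ⇒ (b ∨ ((a' ≺ b) ∨ ∼f (a ⇒ a')))
  split = deduction (∨-elim ∼-excludedMiddle
    (∨-elim (ax (A11 a' b) · (#0 · #1)) (∨-introˡ #0) (∨-introʳ (∨-introˡ #0)))
    (∨-introʳ (∨-introʳ #0)))

≺-antimonoʳ : ∀ a b b' → ∅ ⊢w ¬f (∼f (b' ⇒ b)) ⇒ ((a ≺ b) ⇒ (a ≺ b'))
≺-antimonoʳ a b b' = deduction (deduction
  (∨-elim (fromTheorem (≺-residuation split) · #0) #0 (⊥f-elim (#2 · #0))))
  where
  split : ∅ ⊢w a ⇒ (b ∨ ((a ≺ b') ∨ ∼f (b' ⇒ b)))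
  split = deduction (∨-elim (ax (A11 a b') · #0)
    (∨-elim ∼-excludedMiddle (∨-introˡ (#0 · #1)) (∨-introʳ (∨-introʳ #0)))
    (∨-introʳ (∨-introˡ #0)))

≺-cong : ∀ a a' b b' →
  ∅ ⊢w ¬f (∼f (a ⇔ a')) ⇒ (¬f (∼f (b ⇔ b')) ⇒ ((a ≺ b) ⇔ (a' ≺ b')))
≺-cong a a' b b' = deduction (deduction (∧-intro
  (deduction (fromTheorem (≺-antimonoʳ a' b b') · (¬∼⇐ · #1)
               · (fromTheorem (≺-monoˡ a a' b) · (¬∼⇒ · #2) · #0)))
  (deduction (fromTheorem (≺-antimonoʳ a b' b) · (¬∼⇒ · #1)
               · (fromTheorem (≺-monoˡ a' a b') · (¬∼⇐ · #2) · #0)))))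
  where
  ¬∼⇒ : ∀ {Γ c c'} → Γ ⊢w ¬f (∼f (c ⇔ c')) ⇒ ¬f (∼f (c ⇒ c'))
  ¬∼⇒ = fromTheorem (¬∼-mono (deduction (∧-elimˡ #0)))
  ¬∼⇐ : ∀ {Γ c c'} → Γ ⊢w ¬f (∼f (c ⇔ c')) ⇒ ¬f (∼f (c' ⇒ c))
  ¬∼⇐ = fromTheorem (¬∼-mono (deduction (∧-elimʳ #0)))

mainTheorem5 : (∀ (x : Prop) → ∅ ⊢wS Δ (var x) (var x))
    × (∀ (x y : Prop) → x ≢ y → (⟦ var x ⟧ ∪ Δ (var x) (var y)) ⊢w var y)
    × ∅ ⊢wS Δ ⊤f ⊤f
    × ∅ ⊢wS Δ ⊥f ⊥f
    × (∀ (x₁ y₁ x₂ y₂ : Prop) →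
    x₁ ≢ y₁ → x₁ ≢ x₂ → x₁ ≢ y₂ → y₁ ≢ x₂ → y₁ ≢ y₂ → x₂ ≢ y₂ →
    let Γ = Δ (var x₁) (var y₁) ∪ Δ (var x₂) (var y₂) in
    (Γ ⊢wS Δ (var x₁ ∧ var x₂) (var y₁ ∧ var y₂))
    × (Γ ⊢wS Δ (var x₁ ∨ var x₂) (var y₁ ∨ var y₂))
    × (Γ ⊢wS Δ (var x₁ ⇒ var x₂) (var y₁ ⇒ var y₂))
    × (Γ ⊢wS Δ (var x₁ ≺ var x₂) (var y₁ ≺ var y₂)))
mainTheorem5 =
  (λ x → Δ-refl (var x)) ,
  (λ x y _ → Δ-mp (var x) (var y)) ,
  Δ-refl ⊤f , Δ-refl ⊥f ,
  λ x₁ y₁ x₂ y₂ _ _ _ _ _ _ →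
    Δ-cong₂ _∧_ 0 ∧-cong (var x₁) (var y₁) (var x₂) (var y₂) ,
    Δ-cong₂ _∨_ 0 ∨-cong (var x₁) (var y₁) (var x₂) (var y₂) ,
    Δ-cong₂ _⇒_ 0 ⇒-cong (var x₁) (var y₁) (var x₂) (var y₂) ,
    Δ-cong₂ _≺_ 1 ≺-cong (var x₁) (var y₁) (var x₂) (var y₂)
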